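{- Let $(A,W)$ be a Pratt comonoid and let $x_i$ $(i\in I)$ be elements of $W$ such that each $a\in A$ belongs to only finitely many of the $x_i$. Then $\bigcup_{i\in I}x_i\in W$.
   Context: A Pratt comonoid is a pair $(A,W)$ with $A$ a set and $W$ a set of subsets of $A$ such that (i) $\emptyset\in W$ and $A\in W$; (ii) whenever $C\subseteq A\times A$ is such that for every $a\in A$ both the row $\{b\mid (a,b)\in C\}$ and the column $\{b\mid (b,a)\in C\}$ belong to $W$, the diagonal $\{b\mid (b,b)\in C\}$ also belongs to $W$. -}

module Defs where

open import Data.Bool using (Bool; true; false)
open import Data.Product using (_×_; Σ; ∃; _,_)
open import Data.List using (List)
open import Data.List.Membership.Propositional using (_∈_)
open import Relation.Binary.PropositionalEquality using (_≡_)
open import Function using (_⇔_)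

-- A subset of A is represented by its characteristic function A → Bool
-- (classically every subset is of this form).
Subset : Set → Set
Subset A = A → Bool

_∈ₛ_ : {A : Set} → A → Subset A → Set
a ∈ₛ x = x a ≡ true

_≐_ : {A : Set} → Subset A → Subset A → Set
x ≐ y = ∀ a → x a ≡ y a

∅ₛ : {A : Set} → Subset A
∅ₛ _ = false

Fullₛ : {A : Set} → Subset A
Fullₛ _ = true

-- A Pratt comonoid structure on A: a family W of subsets of A.
-- Since W is a *set* of subsets, membership in W is invariant under
-- extensional equality of subsets.
record IsPrattComonoid (A : Set) (W : Subset A → Set) : Set where
  field
    W-ext   : ∀ {x y} → x ≐ y → W x → W y
    W-empty : W ∅ₛ
    W-full  : W Fullₛ
    W-diag  : (C : A → A → Bool) →
              (∀ a → W (λ b → C a b)) →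
              (∀ a → W (λ b → C b a)) →
              W (λ b → C b b)

IsUnion : {A I : Set} → (I → Subset A) → Subset A → Set
IsUnion {A} {I} x u = ∀ a → (a ∈ₛ u) ⇔ ∃ (λ (i : I) → a ∈ₛ x i)

PointFinite : {A I : Set} → (I → Subset A) → Set
PointFinite {A} {I} x = ∀ (a : A) → Σ (List I) (λ L → ∀ i → a ∈ₛ x i → i ∈ L)

-- Let L a list the indices of the members containing a, and relate a to b
-- when some x i with i ∈ L a contains both.  Row a is then a finite union of
-- members of W, hence in W (binary unions are diagonals of C a b = x a ∨ y b).
-- By point-finiteness the relation just says that a and b share a member, so
-- it is symmetric: columns are rows, and the diagonal is the union.
module Submission where

open import Defs
open import Data.Bool using (Bool; true; false; _∧_; _∨_)
open import Data.Bool.ListAction using (any)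
open import Data.Bool.Properties using (T-≡; ⇔→≡; ∨-zeroʳ; ∨-identityʳ)
open import Data.Product using (_×_; ∃; _,_; proj₁; proj₂)
open import Data.List using (List; []; _∷_)
open import Data.List.Membership.Propositional using (_∈_; lose; find)
open import Data.List.Relation.Unary.Any.Properties using (any⁺; any⁻)
open import Relation.Binary.PropositionalEquality using (_≡_; refl; sym)
open import Function using (_⇔_; mk⇔; Equivalence)
open import Function.Properties.Equivalence using () renaming (trans to ⇔-trans; sym to ⇔-sym)

∧≡true⇔ : ∀ {p q : Bool} → p ∧ q ≡ true ⇔ (p ≡ true × q ≡ true)
∧≡true⇔ {true}  {true} = mk⇔ (λ _ → refl , refl) (λ _ → refl)
∧≡true⇔ {true}  {false} = mk⇔ (λ ()) proj₂
∧≡true⇔ {false} = mk⇔ (λ ()) proj₁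

⋃ : {A I : Set} → List I → (I → Subset A) → Subset A
⋃ L y b = any (λ i → y i b) L

module _ {A I : Set} {L : List I} {y : I → Subset A} {b : A} where

  ∈-⋃⁺ : ∀ {i} → i ∈ L → b ∈ₛ y i → b ∈ₛ ⋃ L y
  ∈-⋃⁺ i∈L b∈yi =
    Equivalence.to T-≡ (any⁺ _ (lose i∈L (Equivalence.from T-≡ b∈yi)))

  ∈-⋃⁻ : b ∈ₛ ⋃ L y → ∃ λ i → b ∈ₛ y i
  ∈-⋃⁻ b∈⋃ with find (any⁻ _ L (Equivalence.from T-≡ b∈⋃))
  ... | i , _ , b∈yi = i , Equivalence.to T-≡ b∈yi

module _ {A : Set} {W : Subset A → Set} (P : IsPrattComonoid A W) where
  open IsPrattComonoid P

  W-∪ : ∀ {x y} → W x → W y → W (λ b → x b ∨ y b)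
  W-∪ {x} {y} wx wy = W-diag (λ a b → x a ∨ y b) row col
    where
    row : ∀ a → W (λ b → x a ∨ y b)
    row a with x a
    ... | true  = W-full
    ... | false = wy
    col : ∀ a → W (λ b → x b ∨ y a)
    col a with y a
    ... | true  = W-ext (λ b → sym (∨-zeroʳ (x b))) W-full
    ... | false = W-ext (λ b → sym (∨-identityʳ (x b))) wx

  W-⋃ : {I : Set} {y : I → Subset A} → (∀ i → W (y i)) → ∀ L → W (⋃ L y)
  W-⋃ wy []      = W-empty
  W-⋃ wy (i ∷ L) = W-∪ (wy i) (W-⋃ wy L)

  W-∧ : ∀ c {x} → W x → W (λ b → c ∧ x b)
  W-∧ true  wx = wx
  W-∧ false wx = W-empty

  W-diag-sym : (C : A → A → Bool) → (∀ a b → C a b ≡ C b a) →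
               (∀ a → W (λ b → C a b)) → W (λ b → C b b)
  W-diag-sym C C-sym rows = W-diag C rows (λ a → W-ext (C-sym a) (rows a))

module PointFiniteFamily {A I : Set} (x : I → Subset A) (pf : PointFinite x) where

  covers : A → List I
  covers a = proj₁ (pf a)

  traceAt : A → I → Subset A
  traceAt a i b = x i a ∧ x i b

  shareMember : A → A → Bool
  shareMember a = ⋃ (covers a) (traceAt a)

  shareMember⇔ : ∀ a b →
    shareMember a b ≡ true ⇔ ∃ λ i → a ∈ₛ x i × b ∈ₛ x i
  shareMember⇔ a b = mk⇔ sound complete
    where
    sound : shareMember a b ≡ true → ∃ λ i → a ∈ₛ x i × b ∈ₛ x i
    sound e with ∈-⋃⁻ {L = covers a} {y = traceAt a} e
    ... | i , e′ = i , Equivalence.to ∧≡true⇔ e′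
    complete : (∃ λ i → a ∈ₛ x i × b ∈ₛ x i) → shareMember a b ≡ true
    complete (i , a∈xi , b∈xi) =
      ∈-⋃⁺ {y = traceAt a} (proj₂ (pf a) i a∈xi)
        (Equivalence.from ∧≡true⇔ (a∈xi , b∈xi))

  shareMember-sym : ∀ a b → shareMember a b ≡ shareMember b a
  shareMember-sym a b = ⇔→≡ (⇔-trans (shareMember⇔ a b)
    (⇔-trans (mk⇔ swap swap) (⇔-sym (shareMember⇔ b a))))
    where
    swap : ∀ {a b} → (∃ λ i → a ∈ₛ x i × b ∈ₛ x i) → ∃ λ i → b ∈ₛ x i × a ∈ₛ x i
    swap (i , p , q) = i , q , p

lemma4p1 : (A : Set) (W : Subset A → Set) → IsPrattComonoid A W →
           (I : Set) (x : I → Subset A) → (∀ i → W (x i)) →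
           PointFinite x →
           (u : Subset A) → IsUnion x u → W u
lemma4p1 A W P I x wx pf u u-union =
  W-ext diagonal≐u (W-diag-sym P shareMember shareMember-sym rows)
  where
  open IsPrattComonoid P
  open PointFiniteFamily x pf
  rows : ∀ a → W (shareMember a)
  rows a = W-⋃ P (λ i → W-∧ P (x i a) (wx i)) (covers a)
  diagonal≐u : (λ b → shareMember b b) ≐ u
  diagonal≐u b = ⇔→≡ (⇔-trans (shareMember⇔ b b)
    (⇔-trans (mk⇔ (λ (i , p , _) → i , p) (λ (i , p) → i , p , p))
             (⇔-sym (u-union b))))
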